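{- Let $\mathbf{A}$ be a two-element semilattice and $C=\mathrm{Clo}(\mathbf{A})$. Then the relational structure $(A;C^{\bullet})$ is not polymorphism-homogeneous.
   Context: The graph of an $n$-ary operation $f$ is $f^\bullet=\{(a_1,\dots,a_{n+1})\in A^{n+1}: f(a_1,\dots,a_n)=a_{n+1}\}$, and $C^\bullet=\{f^\bullet: f\in C\}$. A partial $k$-ary operation $h$ (domain $\mathrm{dom}\,h\subseteq A^k$) preserves $\rho\subseteq A^n$ if for every $n\times k$ matrix whose columns lie in $\rho$ and rows $r_1,\dots,r_n$ lie in $\mathrm{dom}\,h$, $(h(r_1),\dots,h(r_n))\in\rho$. A relational structure $(A;R)$ is polymorphism-homogeneous if for every $k\ge1$ every partial $k$-ary operation preserving all of $R$ extends to a total $k$-ary operation preserving all of $R$. -}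

module Defs where

open import Data.Nat using (ℕ; suc)
open import Data.Fin using (Fin; inject₁; fromℕ)
open import Data.Maybe using (Maybe; just)
open import Data.Product using (Σ; ∃)
open import Relation.Binary.PropositionalEquality using (_≡_)

data Term (n : ℕ) : Set where
  var : Fin n → Term n
  _·_ : Term n → Term n → Term n

module _ {A : Set} (_∙_ : A → A → A) where

  eval : ∀ {n} → Term n → (Fin n → A) → A
  eval (var i) x = x i
  eval (s · t) x = eval s x ∙ eval t x

  InClo : (n : ℕ) → ((Fin n → A) → A) → Set
  InClo n f = Σ (Term n) λ t → ∀ x → f x ≡ eval t x

graph : {A : Set} {n : ℕ} → ((Fin n → A) → A) → (Fin (suc n) → A) → Set
graph {n = n} f x = f (λ i → x (inject₁ i)) ≡ x (fromℕ n)

PartialOp : Set → ℕ → Set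
PartialOp A k = (Fin k → A) → Maybe A

PPreserves : {A : Set} {k n : ℕ} → PartialOp A k → ((Fin n → A) → Set) → Set
PPreserves {A} {k} {n} h ρ =
  (M : Fin n → Fin k → A) (b : Fin n → A) →
  (∀ j → ρ (λ i → M i j)) → (∀ i → h (M i) ≡ just (b i)) → ρ b

Preserves : {A : Set} {k n : ℕ} → ((Fin k → A) → A) → ((Fin n → A) → Set) → Set
Preserves {A} {k} {n} f ρ =
  (M : Fin n → Fin k → A) → (∀ j → ρ (λ i → M i j)) → ρ (λ i → f (M i))

PPreservesC• : {A : Set} (_∙_ : A → A → A) {k : ℕ} → PartialOp A k → Set
PPreservesC• _∙_ h = ∀ n f → InClo _∙_ n f → PPreserves h (graph f)

PreservesC• : {A : Set} (_∙_ : A → A → A) {k : ℕ} → ((Fin k → A) → A) → Set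
PreservesC• _∙_ g = ∀ n f → InClo _∙_ n f → Preserves g (graph f)

PolyHomogeneousC• : {A : Set} → (A → A → A) → Set
PolyHomogeneousC• {A} _∙_ =
  (k : ℕ) (h : PartialOp A (suc k)) → PPreservesC• _∙_ h →
  ∃ λ (g : (Fin (suc k) → A) → A) →
    (∀ r a → h r ≡ just a → g r ≡ a) × PreservesC• _∙_ g
  where open import Data.Product using (_×_)

-- Let u₀,…,u₂ be the "unit rows" of A³: u_c has hi in position c and lo
-- elsewhere.  The partial ternary operation h with domain {u₀, u₁, u₂} and
-- values h(u₀) = h(u₁) = hi, h(u₂) = lo preserves every graph f•, f ∈ Clo(A):
-- if the last row of a matrix is u_c, then column c is a tuple on which a term
-- evaluates to hi, so every variable of the term that the term reads in column
-- c is hi, i.e. the corresponding rows are u_c as well, and they are sent to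
-- h(u_c); by idempotence the term then evaluates to h(u_c).  This works for
-- any arity k and any choice of values, and is proved in that generality.
-- On the other hand a total extension g preserving the graph of x ∙ y is a
-- homomorphism, so g(lo,lo,lo) = g(u₀) ∙ g(u₁) = hi, while also
-- g(lo,lo,lo) = g(lo,lo,lo) ∙ g(u₂) = hi ∙ lo = lo, a contradiction.
module Submission where

open import Defs
open import Data.Nat using (ℕ)
open import Data.Fin using (Fin; zero; suc; fromℕ; inject₁)
open import Data.Fin.Properties using (any?; all?)
import Data.Fin.Properties as Fin
open import Data.Maybe using (just; nothing)
open import Data.Product using (Σ; ∃; _×_; _,_)
open import Data.Sum using (_⊎_; inj₁; inj₂; swap)
open import Data.Empty using (⊥-elim)
open import Function.Bundles using (_↔_; Inverse)
open import Relation.Binary.PropositionalEquality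
  using (_≡_; _≢_; refl; sym; trans; cong; cong₂; module ≡-Reasoning)
open import Relation.Binary.Definitions using (DecidableEquality)
open import Relation.Nullary using (¬_; Dec; yes; no)
open import Algebra.Lattice.Structures using (IsSemilattice)

-- If a term evaluates to an element `top` that cannot be written as a ∙ b
-- except as top ∙ top, then every variable of the term is top; so replacing
-- all those variables by a single value a makes the term (by idempotence)
-- evaluate to a.
eval-collapse : {A : Set} (_∙_ : A → A → A) → (∀ a → a ∙ a ≡ a) →
                (top : A) → (∀ a b → a ∙ b ≡ top → a ≡ top × b ≡ top) →
                ∀ {n} (t : Term n) (y z : Fin n → A) (a : A) →
                eval _∙_ t y ≡ top → (∀ i → y i ≡ top → z i ≡ a) →
                eval _∙_ t z ≡ a
eval-collapse _∙_ idem top prime (var i) y z a ty≡top same = same i ty≡top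
eval-collapse _∙_ idem top prime (s · t) y z a sty≡top same
  with prime (eval _∙_ s y) (eval _∙_ t y) sty≡top
... | sy≡top , ty≡top =
  trans (cong₂ _∙_ (eval-collapse _∙_ idem top prime s y z a sy≡top same)
                   (eval-collapse _∙_ idem top prime t y z a ty≡top same))
        (idem a)

preserves-∙⇒hom : {A : Set} (_∙_ : A → A → A) {k : ℕ} →
  ∀ (g : (Fin k → A) → A) → Preserves g (graph (λ x → x zero ∙ x (suc zero))) →
  ∀ r s t → (∀ j → r j ∙ s j ≡ t j) → g r ∙ g s ≡ g t
preserves-∙⇒hom {A} _∙_ {k} g pres r s t rs≡t = pres rows rs≡t
  where
  rows : Fin 3 → Fin k → A
  rows zero = r
  rows (suc zero) = s
  rows (suc (suc _)) = t

record TwoElementSemilattice {A : Set} (_∙_ : A → A → A) : Set where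
  field
    idem : ∀ a → a ∙ a ≡ a
    comm : ∀ a b → a ∙ b ≡ b ∙ a
    lo hi : A
    lo∙hi : lo ∙ hi ≡ lo
    lo≢hi : lo ≢ hi
    lo-or-hi : ∀ a → a ≡ lo ⊎ a ≡ hi

module TwoElement {A : Set} {_∙_ : A → A → A} (S : TwoElementSemilattice _∙_) where
  open TwoElementSemilattice S

  hi∙lo : hi ∙ lo ≡ lo
  hi∙lo = trans (comm hi lo) lo∙hi

  hi-prime : ∀ a b → a ∙ b ≡ hi → a ≡ hi × b ≡ hi
  hi-prime a b ab≡hi with lo-or-hi a | lo-or-hi b
  ... | inj₂ a≡hi | inj₂ b≡hi = a≡hi , b≡hi
  ... | inj₁ refl | inj₁ refl = ⊥-elim (lo≢hi (trans (sym (idem lo)) ab≡hi))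
  ... | inj₁ refl | inj₂ refl = ⊥-elim (lo≢hi (trans (sym lo∙hi) ab≡hi))
  ... | inj₂ refl | inj₁ refl = ⊥-elim (lo≢hi (trans (sym hi∙lo) ab≡hi))

  _≟_ : DecidableEquality A
  a ≟ b with lo-or-hi a | lo-or-hi b
  ... | inj₁ refl | inj₁ refl = yes refl
  ... | inj₂ refl | inj₂ refl = yes refl
  ... | inj₁ refl | inj₂ refl = no lo≢hi
  ... | inj₂ refl | inj₁ refl = no λ hi≡lo → lo≢hi (sym hi≡lo)

  unit : ∀ {k} → Fin k → Fin k → A
  unit c j with c Fin.≟ j
  ... | yes _ = hi
  ... | no _ = lo

  unit-diag : ∀ {k} (c : Fin k) → unit c c ≡ hi
  unit-diag c with c Fin.≟ c
  ... | yes _ = refl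
  ... | no c≢c = ⊥-elim (c≢c refl)

  unit-hi⇒diag : ∀ {k} (c j : Fin k) → unit c j ≡ hi → c ≡ j
  unit-hi⇒diag c j ucj≡hi with c Fin.≟ j
  ... | yes c≡j = c≡j
  ... | no _ = ⊥-elim (lo≢hi ucj≡hi)

  IsUnit : ∀ {k} → (Fin k → A) → Fin k → Set
  IsUnit x c = ∀ j → x j ≡ unit c j

  unit? : ∀ {k} (x : Fin k → A) → Dec (∃ (IsUnit x))
  unit? x = any? λ c → all? λ j → x j ≟ unit c j

  module UnitRowOperation {k : ℕ} (val : Fin k → A) where

    h : PartialOp A k
    h x with unit? x
    ... | yes (c , _) = just (val c)
    ... | no _ = nothing

    h-unit : ∀ c → h (unit c) ≡ just (val c)
    h-unit c with unit? (unit c)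
    ... | yes (c′ , uc≡uc′) =
      cong (λ d → just (val d)) (unit-hi⇒diag c′ c (trans (sym (uc≡uc′ c)) (unit-diag c)))
    ... | no not-unit = ⊥-elim (not-unit (c , λ _ → refl))

    h-defined : ∀ x v → h x ≡ just v → Σ (Fin k) λ c → IsUnit x c × v ≡ val c
    h-defined x v hx≡v with unit? x
    h-defined x .(val c) refl | yes (c , x≡uc) = c , x≡uc , refl

    -- If the last row of a matrix is unit c, column c evaluates the term to
    -- hi; the rows hi in column c are unit c too and are sent to val c.
    h-preserves : PPreservesC• _∙_ h
    h-preserves n f (t , f≡t) M b columns rows
      with h-defined (M (fromℕ n)) (b (fromℕ n)) (rows (fromℕ n))
    ... | c , last≡uc , bₙ≡val =
      trans (f≡t _) (trans (eval-collapse _∙_ idem hi hi-prime t _ _ (val c) column-hi row-value)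
                           (sym bₙ≡val))
      where
      column-hi : eval _∙_ t (λ i → M (inject₁ i) c) ≡ hi
      column-hi = trans (sym (f≡t _)) (trans (columns c) (trans (last≡uc c) (unit-diag c)))

      row-value : ∀ i → M (inject₁ i) c ≡ hi → b (inject₁ i) ≡ val c
      row-value i Mic≡hi with h-defined _ _ (rows (inject₁ i))
      ... | c′ , Mi≡uc′ , bᵢ≡val =
        trans bᵢ≡val (cong val (unit-hi⇒diag c′ c (trans (sym (Mi≡uc′ c)) Mic≡hi)))

  values : Fin 3 → A
  values zero = hi
  values (suc zero) = hi
  values (suc (suc _)) = lo

  open UnitRowOperation
  open ≡-Reasoning

  -- The ternary instance has no total extension g preserving C•: g would be
  -- a homomorphism, forcing g(lo,lo,lo) to be both hi ∙ hi = hi and hi ∙ lo = lo.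
  not-homogeneous : ¬ PolyHomogeneousC• _∙_
  not-homogeneous homogeneous with homogeneous 2 (h values) (h-preserves values)
  ... | g , extends , preserves = lo≢hi (trans (sym g-lows≡lo) g-lows≡hi)
    where
    lows : Fin 3 → A
    lows _ = lo

    g-unit : ∀ c → g (unit c) ≡ values c
    g-unit c = extends _ _ (h-unit values c)

    g-hom : ∀ r s t → (∀ j → r j ∙ s j ≡ t j) → g r ∙ g s ≡ g t
    g-hom = preserves-∙⇒hom _∙_ g (preserves 2 _ (var zero · var (suc zero) , λ _ → refl))

    u₀∙u₁≡lows : ∀ j → unit zero j ∙ unit (suc zero) j ≡ lo
    u₀∙u₁≡lows zero = hi∙lo
    u₀∙u₁≡lows (suc zero) = lo∙hi
    u₀∙u₁≡lows (suc (suc zero)) = idem lo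

    lows∙u₂≡lows : ∀ j → lo ∙ unit (suc (suc zero)) j ≡ lo
    lows∙u₂≡lows zero = idem lo
    lows∙u₂≡lows (suc zero) = idem lo
    lows∙u₂≡lows (suc (suc zero)) = lo∙hi

    g-lows≡hi : g lows ≡ hi
    g-lows≡hi = begin
      g lows                               ≡⟨ sym (g-hom _ _ lows u₀∙u₁≡lows) ⟩
      g (unit zero) ∙ g (unit (suc zero))  ≡⟨ cong₂ _∙_ (g-unit zero) (g-unit (suc zero)) ⟩
      hi ∙ hi                              ≡⟨ idem hi ⟩
      hi                                   ∎

    g-lows≡lo : g lows ≡ lo
    g-lows≡lo = begin
      g lows                               ≡⟨ sym (g-hom lows _ lows lows∙u₂≡lows) ⟩
      g lows ∙ g (unit (suc (suc zero)))   ≡⟨ cong₂ _∙_ g-lows≡hi (g-unit (suc (suc zero))) ⟩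
      hi ∙ lo                              ≡⟨ hi∙lo ⟩
      lo                                   ∎

two-elements : {A : Set} → A ↔ Fin 2 →
               Σ A λ u → Σ A λ v → u ≢ v × (∀ a → a ≡ u ⊎ a ≡ v)
two-elements iso = from zero , from (suc zero) , distinct , cover
  where
  open Inverse iso
  distinct : from zero ≢ from (suc zero)
  distinct u≡v with trans (sym (strictlyInverseˡ zero))
                          (trans (cong to u≡v) (strictlyInverseˡ (suc zero)))
  ... | ()
  cover : ∀ a → a ≡ from zero ⊎ a ≡ from (suc zero)
  cover a with to a in to-a
  ... | zero = inj₁ (trans (sym (strictlyInverseʳ a)) (cong from to-a))
  ... | suc zero = inj₂ (trans (sym (strictlyInverseʳ a)) (cong from to-a))

-- A commutative idempotent operation on a two-element set is a two-element
-- semilattice: of the two elements u, v, the product u ∙ v is the absorbing one.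
two-element-semilattice : {A : Set} {_∙_ : A → A → A} →
  (∀ a → a ∙ a ≡ a) → (∀ a b → a ∙ b ≡ b ∙ a) →
  Σ A (λ u → Σ A λ v → u ≢ v × (∀ a → a ≡ u ⊎ a ≡ v)) → TwoElementSemilattice _∙_
two-element-semilattice {_∙_ = _∙_} idem comm (u , v , u≢v , u-or-v) with u-or-v (u ∙ v)
... | inj₁ u∙v≡u = record
  { idem = idem ; comm = comm ; lo = u ; hi = v ; lo∙hi = u∙v≡u
  ; lo≢hi = u≢v ; lo-or-hi = u-or-v }
... | inj₂ u∙v≡v = record
  { idem = idem ; comm = comm ; lo = v ; hi = u ; lo∙hi = trans (comm v u) u∙v≡v
  ; lo≢hi = λ v≡u → u≢v (sym v≡u) ; lo-or-hi = λ a → swap (u-or-v a) }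

lemma4p2 : (A : Set) → A ↔ Fin 2 → (_∙_ : A → A → A) → IsSemilattice _≡_ _∙_ →
    ¬ PolyHomogeneousC• _∙_
lemma4p2 A iso _∙_ isSemilattice =
  TwoElement.not-homogeneous (two-element-semilattice idem comm (two-elements iso))
  where open IsSemilattice _≡_ isSemilattice using (idem; comm)
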